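{- Let $k,\ell\in\mathbb{N}_{>1}$ with $k<\ell$ be multiplicatively independent, and let $R\in\mathbb{N}$. Then there exists $N\in\mathbb{N}_{>R}$ such that for all $n\in\mathbb{N}_{\geq N}$ and all $r\in\{0,\dots,R-1\}$ there exist $s\in\mathbb{N}_{>n}$ and $t\in\mathbb{N}_{>0}$ such that (1) $\ell^{ -t}[k^{s},k^{s}+k^{R})\subseteq [k^n+k^r,\,k^n+k^{r+1})$, and (2) for all $u\in\mathbb{N}$ and all $v\in\{1,\dots,t-1\}$, \[ \ell^{ -t}[k^{s},k^{s}+k^{R})\cap \ell^{ -v}[k^{u},k^{u}+k^{R})=\emptyset. \]
   Context: $\mathbb{N}$ contains $0$. $k,\ell$ are multiplicatively independent if $k^a\neq\ell^b$ for all nonzero $a,b\in\mathbb{Z}$. For $c>0$ and an interval $J\subseteq\mathbb{R}$, $cJ=\{cx: x\in J\}$. -}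

module Defs where

open import Data.Nat as ℕ using (ℕ; zero; suc; _^_)
open import Data.Integer as ℤ using (ℤ; +_; -[1+_])
open import Data.Rational using (ℚ; _/_; _*_; _≤_; _<_; 0ℚ)
open import Data.Product using (Σ; ∃; _×_)
open import Relation.Binary.PropositionalEquality using (_≡_; _≢_)

ℕtoℚ : ℕ → ℚ
ℕtoℚ n = + n / 1

-- reciprocal 1/m of a natural number m (only ever used with m ≥ 1; 1/0 := 0 is a dummy)
invℕ : ℕ → ℚ
invℕ zero    = 0ℚ
invℕ (suc m) = + 1 / suc m

powℤ : ℕ → ℤ → ℚ
powℤ m (+ n)      = ℕtoℚ (m ^ n)
powℤ m -[1+ n ]   = invℕ (m ^ suc n)

MultIndep : ℕ → ℕ → Set
MultIndep k ℓ = (a b : ℤ) → a ≢ + 0 → b ≢ + 0 → powℤ k a ≢ powℤ ℓ b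

Subset : Set₁
Subset = ℚ → Set

Ico : ℚ → ℚ → Subset
Ico a b x = a ≤ x × x < b

scale : ℚ → Subset → Subset
scale c J x = ∃ λ y → J y × x ≡ c * y

_⊆_ : Subset → Subset → Set
A ⊆ B = ∀ x → A x → B x

Disjoint : Subset → Subset → Set
Disjoint A B = ∀ x → A x → B x → Data.Empty.⊥
  where import Data.Empty

{-# OPTIONS --safe #-}
module Submission where

-- Multiplying by ℓ^t, (1) asks that k^s ∈ [ℓ^t A, ℓ^t B − k^R) for A = k^n + k^r, B = k^n + k^(r+1),
-- and (2) that [k^s, k^s + k^R) meets no ℓ^w [k^u, k^u + k^R) with 0 < w < t.
-- Since k and ℓ are multiplicatively independent, pigeonholing the ratios ℓ^b / k^⌊b log_k ℓ⌋ gives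
-- powers with k^a / ℓ^b ≠ 1 arbitrarily close to 1, and stepping along multiples of (a, b) puts
-- k^s₀ / ℓ^t₀ into [A + 1/4, A + 1/2] with t₀ as large as we like.
-- Whenever [k^s, k^s + k^R) meets ℓ^w [k^u, k^u + k^R), pass from (s, t) to (u, t − w): then k^s / ℓ^t
-- can only decrease and (k^s + 2k^R) / ℓ^t only increase, so (1) persists while 8k^R ≤ ℓ^t.
-- As t decreases this stops at a pair satisfying (2); it never reaches t < T₀ = 8k^R, because for
-- 0 < t ≤ T₀ and n large no power of k lies within k^R of ℓ^t k^n.

open import Defs
open import Data.Nat using (ℕ; zero; suc; _+_; _*_; _∸_; _^_; _≤_; _<_; _>_; z≤n; s≤s; z<s; _≤?_; _<?_; NonZero; >-nonZero)
open import Data.Nat.Properties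
open import Algebra.Properties.CommutativeSemigroup *-commutativeSemigroup using (x∙yz≈y∙xz)
open import Data.Nat.Tactic.RingSolver using (solve-∀)
open import Data.Nat.Induction using (<-rec)
import Data.Nat.Coprimality as Coprime
import Data.Integer as ℤ
import Data.Integer.Properties as ℤₚ
open import Data.Rational as ℚ using (mkℚ; Positive; NonNegative)
import Data.Rational.Properties as ℚₚ
open import Data.Fin as Fin using (Fin; toℕ; fromℕ<)
open import Data.Fin.Properties using (pigeonhole; toℕ-fromℕ<)
open import Data.Product using (∃; ∃₂; _×_; _,_; proj₁; proj₂; uncurry)
open import Data.Sum using (_⊎_; inj₁; inj₂)
open import Data.Empty using (⊥; ⊥-elim)
open import Relation.Nullary using (¬_; Dec; yes; no; _×-dec_)
open import Relation.Unary using (Decidable)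
open import Relation.Binary.Definitions using (Tri; tri<; tri≈; tri>)
open import Relation.Binary.PropositionalEquality

ℕtoℚ≡mkℚ : ∀ n → ℕtoℚ n ≡ mkℚ (ℤ.+ n) 0 (Coprime.sym (Coprime.1-coprimeTo n))
ℕtoℚ≡mkℚ n = ℚₚ.normalize-coprime {n} {0} _

ℕtoℚ-* : ∀ m n → ℕtoℚ (m * n) ≡ ℕtoℚ m ℚ.* ℕtoℚ n
ℕtoℚ-* m n rewrite ℕtoℚ≡mkℚ m | ℕtoℚ≡mkℚ n = cong (ℚ._/ 1) (ℤₚ.pos-* m n)

ℕtoℚ-mono-≤ : ∀ {m n} → m ≤ n → ℕtoℚ m ℚ.≤ ℕtoℚ n
ℕtoℚ-mono-≤ {m} {n} m≤n rewrite ℕtoℚ≡mkℚ m | ℕtoℚ≡mkℚ n =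
  ℚ.*≤* (subst₂ ℤ._≤_ (sym (ℤₚ.*-identityʳ (ℤ.+ m))) (sym (ℤₚ.*-identityʳ (ℤ.+ n))) (ℤ.+≤+ m≤n))

ℕtoℚ-cancel-< : ∀ {m n} → ℕtoℚ m ℚ.< ℕtoℚ n → m < n
ℕtoℚ-cancel-< {m} {n} p rewrite ℕtoℚ≡mkℚ m | ℕtoℚ≡mkℚ n with p
... | ℚ.*<* q = ℤₚ.drop‿+<+ (subst₂ ℤ._<_ (ℤₚ.*-identityʳ (ℤ.+ m)) (ℤₚ.*-identityʳ (ℤ.+ n)) q)

ℕtoℚ-nonNeg : ∀ n → NonNegative (ℕtoℚ n)
ℕtoℚ-nonNeg n rewrite ℕtoℚ≡mkℚ n = _

ℕtoℚ-pos : ∀ m → Positive (ℕtoℚ (suc m))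
ℕtoℚ-pos m rewrite ℕtoℚ≡mkℚ (suc m) = _

ℕtoℚ-*-invℕ : ∀ {M} y → 0 < M → ℕtoℚ M ℚ.* (invℕ M ℚ.* y) ≡ y
ℕtoℚ-*-invℕ {M@(suc m)} y _ = begin
  ℕtoℚ M ℚ.* (invℕ M ℚ.* y)   ≡⟨ ℚₚ.*-assoc (ℕtoℚ M) (invℕ M) y ⟨
  (ℕtoℚ M ℚ.* invℕ M) ℚ.* y   ≡⟨ cong (ℚ._* y) M*1/M≡1 ⟩
  ℚ.1ℚ ℚ.* y                  ≡⟨ ℚₚ.*-identityˡ y ⟩
  y                           ∎
  where
  open ≡-Reasoning
  M*1/M≡1 : ℕtoℚ M ℚ.* invℕ M ≡ ℚ.1ℚ
  M*1/M≡1 rewrite ℕtoℚ≡mkℚ M | ℚₚ.normalize-coprime {1} {m} (Coprime.1-coprimeTo M) =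
    ℚₚ.*-inverseʳ (mkℚ (ℤ.+ M) 0 (Coprime.sym (Coprime.1-coprimeTo M)))

scale-Ico-⊆ : ∀ {M a b c d} → 0 < M → M * c ≤ a → b ≤ M * d →
  scale (invℕ M) (Ico (ℕtoℚ a) (ℕtoℚ b)) ⊆ Ico (ℕtoℚ c) (ℕtoℚ d)
scale-Ico-⊆ {M@(suc m)} {a} {b} {c} {d} 0<M Mc≤a b≤Md _ (y , (a≤y , y<b) , refl) =
  ℚₚ.*-cancelˡ-≤-pos (ℕtoℚ M) {{ℕtoℚ-pos m}} lower , ℚₚ.*-cancelˡ-<-nonNeg (ℕtoℚ M) {{ℕtoℚ-nonNeg M}} upper
  where
  open ℚₚ.≤-Reasoning
  lower : ℕtoℚ M ℚ.* ℕtoℚ c ℚ.≤ ℕtoℚ M ℚ.* (invℕ M ℚ.* y)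
  lower = begin
    ℕtoℚ M ℚ.* ℕtoℚ c            ≡⟨ ℕtoℚ-* M c ⟨
    ℕtoℚ (M * c)                 ≤⟨ ℕtoℚ-mono-≤ Mc≤a ⟩
    ℕtoℚ a                       ≤⟨ a≤y ⟩
    y                            ≡⟨ ℕtoℚ-*-invℕ y 0<M ⟨
    ℕtoℚ M ℚ.* (invℕ M ℚ.* y)    ∎
  upper : ℕtoℚ M ℚ.* (invℕ M ℚ.* y) ℚ.< ℕtoℚ M ℚ.* ℕtoℚ d
  upper = begin-strict
    ℕtoℚ M ℚ.* (invℕ M ℚ.* y)    ≡⟨ ℕtoℚ-*-invℕ y 0<M ⟩
    y                            <⟨ y<b ⟩
    ℕtoℚ b                       ≤⟨ ℕtoℚ-mono-≤ b≤Md ⟩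
    ℕtoℚ (M * d)                 ≡⟨ ℕtoℚ-* M d ⟩
    ℕtoℚ M ℚ.* ℕtoℚ d            ∎

scale-Ico-meet : ∀ {W V T a b c d x} → 0 < W → 0 < V → T ≡ W * V →
  scale (invℕ T) (Ico (ℕtoℚ a) (ℕtoℚ b)) x → scale (invℕ V) (Ico (ℕtoℚ c) (ℕtoℚ d)) x →
  W * c < b × a < W * d
scale-Ico-meet {W@(suc w)} {V} {T} {a} {b} {c} {d} 0<W 0<V refl (y , (a≤y , y<b) , x≡y/T) (z , (c≤z , z<d) , x≡z/V) =
  ℕtoℚ-cancel-< (begin-strict
    ℕtoℚ (W * c)         ≡⟨ ℕtoℚ-* W c ⟩
    ℕtoℚ W ℚ.* ℕtoℚ c    ≤⟨ ℚₚ.*-monoˡ-≤-nonNeg (ℕtoℚ W) {{ℕtoℚ-nonNeg W}} c≤z ⟩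
    ℕtoℚ W ℚ.* z         ≡⟨ y≡Wz ⟨
    y                    <⟨ y<b ⟩
    ℕtoℚ b               ∎) ,
  ℕtoℚ-cancel-< (begin-strict
    ℕtoℚ a               ≤⟨ a≤y ⟩
    y                    ≡⟨ y≡Wz ⟩
    ℕtoℚ W ℚ.* z         <⟨ ℚₚ.*-monoʳ-<-pos (ℕtoℚ W) {{ℕtoℚ-pos w}} z<d ⟩
    ℕtoℚ W ℚ.* ℕtoℚ d    ≡⟨ ℕtoℚ-* W d ⟨
    ℕtoℚ (W * d)         ∎)
  where
  open ℚₚ.≤-Reasoning
  y≡Wz : y ≡ ℕtoℚ W ℚ.* z
  y≡Wz = begin-equality
    y                                                ≡⟨ ℕtoℚ-*-invℕ y (*-mono-< 0<W 0<V) ⟨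
    ℕtoℚ (W * V) ℚ.* (invℕ (W * V) ℚ.* y)            ≡⟨ cong₂ ℚ._*_ (ℕtoℚ-* W V) (trans (sym x≡y/T) x≡z/V) ⟩
    (ℕtoℚ W ℚ.* ℕtoℚ V) ℚ.* (invℕ V ℚ.* z)           ≡⟨ ℚₚ.*-assoc (ℕtoℚ W) (ℕtoℚ V) (invℕ V ℚ.* z) ⟩
    ℕtoℚ W ℚ.* (ℕtoℚ V ℚ.* (invℕ V ℚ.* z))           ≡⟨ cong (ℕtoℚ W ℚ.*_) (ℕtoℚ-*-invℕ z 0<V) ⟩
    ℕtoℚ W ℚ.* z                                     ∎

n<m^n : ∀ {m} → 1 < m → ∀ n → n < m ^ n
n<m^n         1<m zero    = z<s
n<m^n {m} 1<m (suc n) = begin-strict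
  suc n         ≤⟨ n<m^n 1<m n ⟩
  m ^ n         <⟨ m<m+n (m ^ n) (≤-<-trans z≤n (n<m^n 1<m n)) ⟩
  m ^ n + m ^ n ≡⟨ cong (m ^ n +_) (+-identityʳ (m ^ n)) ⟨
  2 * m ^ n     ≤⟨ *-monoˡ-≤ (m ^ n) 1<m ⟩
  m * m ^ n     ∎
  where open ≤-Reasoning

m^n<m^o⇒n<o : ∀ {m n o} → 1 < m → m ^ n < m ^ o → n < o
m^n<m^o⇒n<o {m@(suc _)} 1<m p = ≰⇒> (λ o≤n → <⇒≱ p (^-monoʳ-≤ m o≤n))

m^n≤m^o⇒n≤o : ∀ {m n o} → 1 < m → m ^ n ≤ m ^ o → n ≤ o
m^n≤m^o⇒n≤o {m} 1<m p = ≮⇒≥ (λ o<n → <⇒≱ (^-monoʳ-< m 1<m o<n) p)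

-- Bernoulli's inequality 1 + F/m ≤ (1 + 1/m)^F, cleared of denominators.
bernoulli : ∀ m F → m ^ F * (m + F) ≤ m * suc m ^ F
bernoulli m zero    = ≤-reflexive (base m)
  where
  base : ∀ m → 1 * (m + 0) ≡ m * 1
  base = solve-∀
bernoulli m (suc F) = begin
  m * X * (m + suc F)           ≡⟨ expand m X F ⟩
  m * X * (m + F) + m * X       ≤⟨ +-monoʳ-≤ (m * X * (m + F)) (*-monoˡ-≤ X (m≤m+n m F)) ⟩
  m * X * (m + F) + (m + F) * X ≡⟨ collect m X F ⟩
  suc m * (X * (m + F))         ≤⟨ *-monoʳ-≤ (suc m) (bernoulli m F) ⟩
  suc m * (m * suc m ^ F)       ≡⟨ x∙yz≈y∙xz (suc m) m (suc m ^ F) ⟩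
  m * suc m ^ suc F             ∎
  where
  open ≤-Reasoning
  X = m ^ F
  expand : ∀ m X F → m * X * (m + suc F) ≡ m * X * (m + F) + m * X
  expand = solve-∀
  collect : ∀ m X F → m * X * (m + F) + (m + F) * X ≡ suc m * (X * (m + F))
  collect = solve-∀

c*m^[m*c]≤[1+m]^[m*c] : ∀ {m} c → 0 < m → c * m ^ (m * c) ≤ suc m ^ (m * c)
c*m^[m*c]≤[1+m]^[m*c] {m@(suc _)} c _ = ≤-trans (*-monoˡ-≤ X (n≤1+n c)) (*-cancelˡ-≤ m (begin
  m * (suc c * X)       ≡⟨ rearrange m c X ⟩
  X * (m + m * c)       ≤⟨ bernoulli m (m * c) ⟩
  m * suc m ^ (m * c)   ∎))
  where
  open ≤-Reasoning
  X = m ^ (m * c)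
  rearrange : ∀ m c X → m * (suc c * X) ≡ X * (m + m * c)
  rearrange = solve-∀

first-crossing : ∀ {p} {P : ℕ → Set p} → Decidable P → ¬ P 0 →
  ∀ {F} → P F → ∃ λ j → j < F × ¬ P j × P (suc j)
first-crossing P? ¬P0 {zero}  P0  = ⊥-elim (¬P0 P0)
first-crossing P? ¬P0 {suc F} PsF with P? F
... | no ¬PF = F , n<1+n F , ¬PF , PsF
... | yes PF with first-crossing P? ¬P0 PF
...   | j , j<F , ¬Pj , Psj = j , m<n⇒m<1+n j<F , ¬Pj , Psj

floor-log : ∀ {m x} → 1 < m → 0 < x → ∃ λ a → m ^ a ≤ x × x < m ^ suc a
floor-log {m} {x} 1<m 0<x with first-crossing (λ a → x <? m ^ a) (≤⇒≯ 0<x) {x} (n<m^n 1<m x)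
... | a , _ , x≮mᵃ , x<mᵃ⁺¹ = a , ≮⇒≥ x≮mᵃ , x<mᵃ⁺¹

-- By Bernoulli (1 + 1/E)^(E c) ≥ c, so the first E c powers of 1 + 1/E cut [1, c) into intervals;
-- i indexes the one containing x/y.
ratio-index : ∀ {E c x y} → 0 < E → y ≤ x → x < c * y →
  ∃ λ i → i < E * c × suc E ^ i * y ≤ E ^ i * x × E ^ suc i * x < suc E ^ suc i * y
ratio-index {E} {c} {x} {y} 0<E@(s≤s _) y≤x x<cy
  with first-crossing (λ i → E ^ i * x <? suc E ^ i * y) (≤⇒≯ (*-monoʳ-≤ 1 y≤x)) beyond
  where
  beyond : E ^ (E * c) * x < suc E ^ (E * c) * y
  beyond = begin-strict
    E ^ (E * c) * x       <⟨ *-monoʳ-< (E ^ (E * c)) {{m^n≢0 E (E * c)}} x<cy ⟩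
    E ^ (E * c) * (c * y) ≡⟨ *-assoc (E ^ (E * c)) c y ⟨
    E ^ (E * c) * c * y   ≡⟨ cong (_* y) (*-comm (E ^ (E * c)) c) ⟩
    c * E ^ (E * c) * y   ≤⟨ *-monoˡ-≤ y (c*m^[m*c]≤[1+m]^[m*c] c 0<E) ⟩
    suc E ^ (E * c) * y   ∎
    where open ≤-Reasoning
... | i , i<Ec , outside , inside = i , i<Ec , ≮⇒≥ outside , inside

quotient-close : ∀ {e p q x y X Y} → 0 < p → 0 < x → 0 < X →
  q * y ≤ p * x → e * p * x < suc e * q * y →
  q * (y * Y) ≤ p * (x * X) → e * p * (x * X) < suc e * q * (y * Y) →
  e * X < suc e * Y × e * Y < suc e * X
quotient-close {e} {p} {q} {x} {y} {X} {Y} 0<p 0<x 0<X lo₁ hi₁ lo₂ hi₂ =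
  *-cancelʳ-< C (e * X) (suc e * Y) (subst₂ _<_ (eq₁ e p q x y X Y) (eq₂ e p q x y X Y)
    (<-≤-mono-* hi₂ lo₁ (*-mono-< 0<p 0<x))) ,
  *-cancelʳ-< C (e * Y) (suc e * X) (subst₂ _<_ (eq₃ e p q x y X Y) (eq₄ e p q x y X Y)
    (<-≤-mono-* hi₁ lo₂ (*-mono-< 0<p (*-mono-< 0<x 0<X))))
  where
  C = p * q * x * y
  <-≤-mono-* : ∀ {a b c d} → a < b → c ≤ d → 0 < d → a * c < b * d
  <-≤-mono-* {a} {d = d@(suc _)} a<b c≤d _ = ≤-<-trans (*-monoʳ-≤ a c≤d) (*-monoˡ-< d a<b)
  eq₁ : ∀ e p q x y X Y → e * p * (x * X) * (q * y) ≡ e * X * (p * q * x * y)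
  eq₁ = solve-∀
  eq₂ : ∀ e p q x y X Y → suc e * q * (y * Y) * (p * x) ≡ suc e * Y * (p * q * x * y)
  eq₂ = solve-∀
  eq₃ : ∀ e p q x y X Y → e * p * x * (q * (y * Y)) ≡ e * Y * (p * q * x * y)
  eq₃ = solve-∀
  eq₄ : ∀ e p q x y X Y → suc e * q * y * (p * (x * X)) ≡ suc e * X * (p * q * x * y)
  eq₄ = solve-∀

infix 4 _⋖[_]_
_⋖[_]_ : ℕ → ℕ → ℕ → Set
x ⋖[ E ] y = x < y × E * y < suc E * x

window-step : ∀ {E L M U X Y α β} → 0 < E → L * suc E ≤ U * E →
  M * X ≤ L * Y → E * α < suc E * β → M * (α * X) ≤ U * (β * Y)
window-step {E} {L} {M} {U} {X} {Y} {α} {β} 0<E@(s≤s _) LE≤UE MX≤LY close = *-cancelˡ-≤ E (begin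
  E * (M * (α * X))       ≡⟨ eq₁ E M α X ⟩
  (M * X) * (E * α)       ≤⟨ *-mono-≤ MX≤LY (<⇒≤ close) ⟩
  (L * Y) * (suc E * β)   ≡⟨ eq₂ E L Y β ⟩
  (L * suc E) * (β * Y)   ≤⟨ *-monoˡ-≤ (β * Y) LE≤UE ⟩
  (U * E) * (β * Y)       ≡⟨ eq₃ E U β Y ⟩
  E * (U * (β * Y))       ∎)
  where
  open ≤-Reasoning
  eq₁ : ∀ E M α X → E * (M * (α * X)) ≡ (M * X) * (E * α)
  eq₁ = solve-∀
  eq₂ : ∀ E L Y β → (L * Y) * (suc E * β) ≡ (L * suc E) * (β * Y)
  eq₂ = solve-∀
  eq₃ : ∀ E U β Y → (U * E) * (β * Y) ≡ E * (U * (β * Y))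
  eq₃ = solve-∀

^-*-+ : ∀ z n m o → z ^ (n * m + o) ≡ (z ^ m) ^ n * z ^ o
^-*-+ z n m o = trans (^-distribˡ-+-* z (n * m) o)
  (cong (_* z ^ o) (trans (cong (z ^_) (*-comm n m)) (sym (^-*-assoc z m n))))

^-suc-*-+ : ∀ z n m o → z ^ (suc n * m + o) ≡ z ^ m * z ^ (n * m + o)
^-suc-*-+ z n m o = trans (cong (z ^_) (+-assoc m (n * m) o)) (^-distribˡ-+-* z m (n * m + o))

-- Walking along (s₀ + j a, t₀ + j b), the ratio x^s / y^t grows by a factor below 1 + 1/E per step,
-- so it cannot jump over the window [L/M, U/M].
walk : ∀ {x y a b E L M U s₀ t₀} → 0 < x → 0 < y → 0 < E → 0 < M → L * suc E ≤ U * E →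
  y ^ b ⋖[ E ] x ^ a → M * x ^ s₀ < L * y ^ t₀ →
  ∃₂ λ s t → s₀ ≤ s × t₀ ≤ t × L * y ^ t ≤ M * x ^ s × M * x ^ s ≤ U * y ^ t
walk {x} {y} {a} {b} {E} {L} {M} {U} {s₀} {t₀} 0<x@(s≤s _) 0<y@(s≤s _) 0<E 0<M LE≤UE (yᵇ<xᵃ , close) initial
  with first-crossing (λ j → L * y ^ (j * b + t₀) ≤? M * x ^ (j * a + s₀)) (<⇒≱ initial) {F} eventually
  where
  c = L * y ^ t₀
  F = y ^ b * c
  eventually : L * y ^ (F * b + t₀) ≤ M * x ^ (F * a + s₀)
  eventually = begin
    L * y ^ (F * b + t₀)         ≡⟨ cong (L *_) (^-*-+ y F b t₀) ⟩
    L * ((y ^ b) ^ F * y ^ t₀)   ≡⟨ reorder L ((y ^ b) ^ F) (y ^ t₀) ⟩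
    c * (y ^ b) ^ F              ≤⟨ c*m^[m*c]≤[1+m]^[m*c] c (m^n>0 y b) ⟩
    suc (y ^ b) ^ F              ≤⟨ ^-monoˡ-≤ F yᵇ<xᵃ ⟩
    (x ^ a) ^ F                  ≤⟨ m≤m*n ((x ^ a) ^ F) (M * x ^ s₀) {{>-nonZero (*-mono-< 0<M (m^n>0 x s₀))}} ⟩
    (x ^ a) ^ F * (M * x ^ s₀)   ≡⟨ x∙yz≈y∙xz ((x ^ a) ^ F) M (x ^ s₀) ⟩
    M * ((x ^ a) ^ F * x ^ s₀)   ≡⟨ cong (M *_) (^-*-+ x F a s₀) ⟨
    M * x ^ (F * a + s₀)         ∎
    where
    open ≤-Reasoning
    reorder : ∀ m p q → m * (p * q) ≡ (m * q) * p
    reorder = solve-∀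
... | j , _ , below , above = suc j * a + s₀ , suc j * b + t₀ , m≤n+m s₀ _ , m≤n+m t₀ _ , above ,
  subst₂ (λ X Y → M * X ≤ U * Y) (sym (^-suc-*-+ x j a s₀)) (sym (^-suc-*-+ y j b t₀))
    (window-step {L = L} {M} {U} 0<E LE≤UE (<⇒≤ (≰⇒> below)) close)

ratio-lower-bound : ∀ {A K K₀ P P₀ Q} → 0 < P₀ → (4 * A + 1) * P₀ ≤ 4 * K₀ →
  (K₀ + 2 * Q) * P ≤ (K + 2 * Q) * P₀ → 8 * Q ≤ P → P * A ≤ K
ratio-lower-bound {A} {K} {K₀} {P} {P₀} {Q} (s≤s _) initial invariant 8Q≤P =
  *-cancelʳ-≤ (P * A) K (4 * P₀) (+-cancelʳ-≤ Z _ _ (begin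
    P * A * (4 * P₀) + Z              ≡⟨ eq₁ A P P₀ Q ⟩
    (4 * A + 1) * P₀ * P + 8 * Q * P  ≤⟨ +-monoˡ-≤ (8 * Q * P) (*-monoˡ-≤ P initial) ⟩
    4 * K₀ * P + 8 * Q * P            ≡⟨ eq₂ K₀ P Q ⟩
    4 * ((K₀ + 2 * Q) * P)            ≤⟨ *-monoʳ-≤ 4 invariant ⟩
    4 * ((K + 2 * Q) * P₀)            ≡⟨ eq₃ K P₀ Q ⟩
    K * (4 * P₀) + 8 * Q * P₀         ≤⟨ +-monoʳ-≤ (K * (4 * P₀)) (≤-trans (*-monoˡ-≤ P₀ 8Q≤P) (m≤m+n (P * P₀) (8 * Q * P))) ⟩
    K * (4 * P₀) + Z                  ∎))
  where
  open ≤-Reasoning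
  Z = P * P₀ + 8 * Q * P
  eq₁ : ∀ A P P₀ Q → P * A * (4 * P₀) + (P * P₀ + 8 * Q * P) ≡ (4 * A + 1) * P₀ * P + 8 * Q * P
  eq₁ = solve-∀
  eq₂ : ∀ K₀ P Q → 4 * K₀ * P + 8 * Q * P ≡ 4 * ((K₀ + 2 * Q) * P)
  eq₂ = solve-∀
  eq₃ : ∀ K P₀ Q → 4 * ((K + 2 * Q) * P₀) ≡ K * (4 * P₀) + 8 * Q * P₀
  eq₃ = solve-∀

ratio-upper-bound : ∀ {A B K K₀ P P₀ Q} → 0 < P₀ → 4 * K₀ ≤ (4 * A + 2) * P₀ →
  K * P₀ ≤ K₀ * P → 4 * Q ≤ P → A < B → K + Q ≤ P * B
ratio-upper-bound {A} {B} {K} {K₀} {P} {P₀} {Q} (s≤s _) initial invariant 4Q≤P A<B =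
  *-cancelʳ-≤ (K + Q) (P * B) (4 * P₀) (begin
    (K + Q) * (4 * P₀)                      ≡⟨ eq₁ K Q P₀ ⟩
    4 * (K * P₀) + 4 * Q * P₀               ≤⟨ +-mono-≤ (*-monoʳ-≤ 4 invariant) (*-monoˡ-≤ P₀ 4Q≤P) ⟩
    4 * (K₀ * P) + P * P₀                   ≡⟨ cong (_+ P * P₀) (*-assoc 4 K₀ P) ⟨
    4 * K₀ * P + P * P₀                     ≤⟨ +-monoˡ-≤ (P * P₀) (*-monoˡ-≤ P initial) ⟩
    (4 * A + 2) * P₀ * P + P * P₀           ≤⟨ m≤m+n _ (P * P₀) ⟩
    (4 * A + 2) * P₀ * P + P * P₀ + P * P₀  ≡⟨ eq₂ A P P₀ ⟩
    4 * suc A * (P * P₀)                    ≤⟨ *-monoˡ-≤ (P * P₀) (*-monoʳ-≤ 4 A<B) ⟩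
    4 * B * (P * P₀)                        ≡⟨ eq₃ B P P₀ ⟩
    P * B * (4 * P₀)                        ∎)
  where
  open ≤-Reasoning
  eq₁ : ∀ K Q P₀ → (K + Q) * (4 * P₀) ≡ 4 * (K * P₀) + 4 * Q * P₀
  eq₁ = solve-∀
  eq₂ : ∀ A P P₀ → (4 * A + 2) * P₀ * P + P * P₀ + P * P₀ ≡ 4 * suc A * (P * P₀)
  eq₂ = solve-∀
  eq₃ : ∀ B P P₀ → 4 * B * (P * P₀) ≡ P * B * (4 * P₀)
  eq₃ = solve-∀

ratio-descends : ∀ {W K Kᵤ K₀ P P₀} → 0 < W → W * Kᵤ < K → K * P₀ ≤ K₀ * (W * P) → Kᵤ * P₀ ≤ K₀ * P
ratio-descends {W} {K} {Kᵤ} {K₀} {P} {P₀} (s≤s _) below invariant = *-cancelˡ-≤ W (begin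
  W * (Kᵤ * P₀)   ≡⟨ *-assoc W Kᵤ P₀ ⟨
  W * Kᵤ * P₀     ≤⟨ *-monoˡ-≤ P₀ (<⇒≤ below) ⟩
  K * P₀          ≤⟨ invariant ⟩
  K₀ * (W * P)    ≡⟨ x∙yz≈y∙xz K₀ W P ⟩
  W * (K₀ * P)    ∎)
  where
  open ≤-Reasoning

-- Since W ≥ 2, the error Q made in passing from K to Kᵤ is absorbed by the slack 2Q.
padded-ratio-ascends : ∀ {W K Kᵤ K₀ P P₀ Q} → 2 ≤ W → K < W * (Kᵤ + Q) →
  (K₀ + 2 * Q) * (W * P) ≤ (K + 2 * Q) * P₀ → (K₀ + 2 * Q) * P ≤ (Kᵤ + 2 * Q) * P₀
padded-ratio-ascends {W} {K} {Kᵤ} {K₀} {P} {P₀} {Q} 2≤W@(s≤s _) above invariant = *-cancelˡ-≤ W (begin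
  W * ((K₀ + 2 * Q) * P)   ≡⟨ x∙yz≈y∙xz W (K₀ + 2 * Q) P ⟩
  (K₀ + 2 * Q) * (W * P)   ≤⟨ invariant ⟩
  (K + 2 * Q) * P₀         ≤⟨ *-monoˡ-≤ P₀ padded ⟩
  W * (Kᵤ + 2 * Q) * P₀    ≡⟨ *-assoc W (Kᵤ + 2 * Q) P₀ ⟩
  W * ((Kᵤ + 2 * Q) * P₀)  ∎)
  where
  open ≤-Reasoning
  distrib : ∀ W Kᵤ Q → W * (Kᵤ + Q) + W * Q ≡ W * (Kᵤ + 2 * Q)
  distrib = solve-∀
  padded : K + 2 * Q ≤ W * (Kᵤ + 2 * Q)
  padded = begin
    K + 2 * Q              ≤⟨ +-mono-≤ (<⇒≤ above) (*-monoˡ-≤ Q 2≤W) ⟩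
    W * (Kᵤ + Q) + W * Q   ≡⟨ distrib W Kᵤ Q ⟩
    W * (Kᵤ + 2 * Q)       ∎

no-multiple-strictly-between : ∀ {K a X} → K * a < K * X → K * X < K * a + K → ⊥
no-multiple-strictly-between {K} {a} {X} Ka<KX KX<Ka+K =
  <⇒≱ (*-cancelˡ-< K X (suc a) (subst (K * X <_) (trans (+-comm (K * a) K) (sym (*-suc K a))) KX<Ka+K))
      (*-cancelˡ-< K a X Ka<KX)

m^a+m^b≤m^n : ∀ {m a b n} → 1 < m → a < n → b < n → m ^ a + m ^ b ≤ m ^ n
m^a+m^b≤m^n {m} {a} {b} {n} 1<m a<n b<n = *-cancelˡ-≤ 2 (begin
  2 * (m ^ a + m ^ b)       ≤⟨ *-monoˡ-≤ (m ^ a + m ^ b) 1<m ⟩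
  m * (m ^ a + m ^ b)       ≡⟨ *-distribˡ-+ m (m ^ a) (m ^ b) ⟩
  m ^ suc a + m ^ suc b     ≤⟨ +-mono-≤ (^-monoʳ-≤ m a<n) (^-monoʳ-≤ m b<n) ⟩
  m ^ n + m ^ n             ≡⟨ cong (m ^ n +_) (+-identityʳ (m ^ n)) ⟨
  2 * m ^ n                 ∎)
  where
  open ≤-Reasoning
  instance
    _ : NonZero m
    _ = >-nonZero (<-trans z<s 1<m)

-- ℓ^w [k^u, k^u + k^R) meets [k^s, k^s + k^R).
Overlap : ℕ → ℕ → ℕ → ℕ → ℕ → ℕ → Set
Overlap k ℓ R s w u = ℓ ^ w * k ^ u < k ^ s + k ^ R × k ^ s < ℓ ^ w * (k ^ u + k ^ R)

Separated : ℕ → ℕ → ℕ → ℕ → ℕ → Set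
Separated k ℓ R s t = ∀ w u → 0 < w → w < t → ¬ Overlap k ℓ R s w u

-- Pairs (s, t) satisfying (1) and (2) multiplied by ℓ^t, where A = k^n + k^r and B = k^n + k^(r+1).
Solution : ℕ → ℕ → ℕ → ℕ → ℕ → ℕ → Set
Solution k ℓ R n A B = ∃₂ λ s t → n < s × 0 < t × ℓ ^ t * A ≤ k ^ s × k ^ s + k ^ R ≤ ℓ ^ t * B × Separated k ℓ R s t

module _ {k ℓ : ℕ} (1<k : 1 < k) (1<ℓ : 1 < ℓ) (k^a≢ℓ^b : ∀ a b → 0 < b → k ^ a ≢ ℓ ^ b) where

  private
    0<k : 0 < k
    0<k = <-trans z<s 1<k
    0<ℓ : 0 < ℓ
    0<ℓ = <-trans z<s 1<ℓ
    instance
      k≢0 : NonZero k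
      k≢0 = >-nonZero 0<k
      ℓ≢0 : NonZero ℓ
      ℓ≢0 = >-nonZero 0<ℓ

  ClosePowers : ℕ → Set
  ClosePowers E = ∃₂ λ a b → ℓ ^ b ⋖[ E ] k ^ a ⊎ k ^ a ⋖[ E ] ℓ ^ b

  IndexedLog : ℕ → ℕ → ℕ → Set
  IndexedLog E b i = ∃ λ a → k ^ a ≤ ℓ ^ b × ℓ ^ b < k ^ suc a ×
    suc E ^ i * k ^ a ≤ E ^ i * ℓ ^ b × E ^ suc i * ℓ ^ b < suc E ^ suc i * k ^ a

  indexedLog : ∀ {E} → 0 < E → ∀ b → ∃ λ i → i < E * k × IndexedLog E b i
  indexedLog 0<E b with floor-log 1<k (m^n>0 ℓ b)
  ... | a , kᵃ≤ℓᵇ , ℓᵇ<kᵃ⁺¹ with ratio-index 0<E kᵃ≤ℓᵇ ℓᵇ<kᵃ⁺¹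
  ...   | i , i<Ek , lower , upper = i , i<Ek , a , kᵃ≤ℓᵇ , ℓᵇ<kᵃ⁺¹ , lower , upper

  same-index⇒close : ∀ {E b₁ b₂ i} → 0 < E → b₁ < b₂ → IndexedLog E b₁ i → IndexedLog E b₂ i → ClosePowers E
  same-index⇒close {E} {b₁} {b₂} {i} 0<E b₁<b₂ (a₁ , kᵃ¹≤ℓᵇ¹ , _ , lo₁ , hi₁) (a₂ , _ , ℓᵇ²<kᵃ²⁺¹ , lo₂ , hi₂)
    with m≤n⇒∃[o]m+o≡n a₁≤a₂ | m≤n⇒∃[o]m+o≡n (<⇒≤ b₁<b₂)
    where
    a₁≤a₂ : a₁ ≤ a₂
    a₁≤a₂ = m<1+n⇒m≤n (m^n<m^o⇒n<o 1<k (≤-<-trans kᵃ¹≤ℓᵇ¹ (≤-<-trans (^-monoʳ-≤ ℓ (<⇒≤ b₁<b₂)) ℓᵇ²<kᵃ²⁺¹)))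
  ... | D , refl | B , refl = compare (<-cmp (ℓ ^ B) (k ^ D))
    where
    0<B : 0 < B
    0<B = +-cancelˡ-< b₁ 0 B (subst (_< b₁ + B) (sym (+-identityʳ b₁)) b₁<b₂)
    close : E * ℓ ^ B < suc E * k ^ D × E * k ^ D < suc E * ℓ ^ B
    close = quotient-close {E} {E ^ i} {suc E ^ i} {ℓ ^ b₁} {k ^ a₁} {ℓ ^ B} {k ^ D}
      (m^n>0 E {{>-nonZero 0<E}} i) (m^n>0 ℓ b₁) (m^n>0 ℓ B) lo₁ hi₁
      (subst₂ (λ K L → suc E ^ i * K ≤ E ^ i * L) (^-distribˡ-+-* k a₁ D) (^-distribˡ-+-* ℓ b₁ B) lo₂)
      (subst₂ (λ K L → E ^ suc i * L < suc E ^ suc i * K) (^-distribˡ-+-* k a₁ D) (^-distribˡ-+-* ℓ b₁ B) hi₂)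
    compare : Tri (ℓ ^ B < k ^ D) (ℓ ^ B ≡ k ^ D) (ℓ ^ B > k ^ D) → ClosePowers E
    compare (tri< ℓᴮ<kᴰ _ _) = D , B , inj₁ (ℓᴮ<kᴰ , proj₂ close)
    compare (tri≈ _ ℓᴮ≡kᴰ _) = ⊥-elim (k^a≢ℓ^b D B 0<B (sym ℓᴮ≡kᴰ))
    compare (tri> _ _ kᴰ<ℓᴮ) = D , B , inj₂ (kᴰ<ℓᴮ , proj₁ close)

  close-powers : ∀ {E} → 0 < E → ClosePowers E
  close-powers {E} 0<E = collide (pigeonhole (n<1+n (E * k)) index)
    where
    log : ∀ b → ∃ λ i → i < E * k × IndexedLog E b i
    log = indexedLog 0<E
    index : Fin (suc (E * k)) → Fin (E * k)
    index b = fromℕ< (proj₁ (proj₂ (log (toℕ b))))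
    collide : (∃₂ λ b₁ b₂ → b₁ Fin.< b₂ × index b₁ ≡ index b₂) → ClosePowers E
    collide (b₁ , b₂ , b₁<b₂ , same) =
      same-index⇒close {i = proj₁ (log (toℕ b₁))} 0<E b₁<b₂ (proj₂ (proj₂ (log (toℕ b₁))))
      (subst (IndexedLog E (toℕ b₂)) (sym same-i) (proj₂ (proj₂ (log (toℕ b₂)))))
      where
      same-i : proj₁ (log (toℕ b₁)) ≡ proj₁ (log (toℕ b₂))
      same-i = trans (sym (toℕ-fromℕ< _)) (trans (cong toℕ same) (toℕ-fromℕ< _))

  ratio-in-window : ∀ {E M} T₀ → 0 < M → M < E →
    ∃₂ λ s t → T₀ ≤ t × E * ℓ ^ t ≤ M * k ^ s × M * k ^ s ≤ suc E * ℓ ^ t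
  ratio-in-window {E} {M} T₀ 0<M M<E = hit (close-powers 0<E)
    where
    0<E : 0 < E
    0<E = <-trans 0<M M<E
    G = E * suc E * ℓ ^ T₀
    ascending-start : M * k ^ 0 < E * ℓ ^ T₀
    ascending-start = begin-strict
      M * 1      ≡⟨ *-identityʳ M ⟩
      M          <⟨ M<E ⟩
      E          ≤⟨ m≤m*n E (ℓ ^ T₀) {{m^n≢0 ℓ T₀}} ⟩
      E * ℓ ^ T₀ ∎
      where open ≤-Reasoning
    -- If k^a < ℓ^b, walk with k and ℓ exchanged, towards the inverted window for ℓ^t / k^s.
    descending-start : E * suc E * ℓ ^ T₀ < M * E * k ^ G
    descending-start = ≤-trans (n<m^n 1<k G) (m≤n*m (k ^ G) (M * E) {{>-nonZero (*-mono-< 0<M 0<E)}})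
    eq₁ : ∀ M E → M * E * suc E ≡ M * suc E * E
    eq₁ = solve-∀
    eq₂ : ∀ E X → E * suc E * X ≡ suc E * (E * X)
    eq₂ = solve-∀
    eq₃ : ∀ E M X → M * suc E * X ≡ suc E * (M * X)
    eq₃ = solve-∀
    eq₄ : ∀ M E X → M * E * X ≡ E * (M * X)
    eq₄ = solve-∀
    hit : ClosePowers E → ∃₂ λ s t → T₀ ≤ t × E * ℓ ^ t ≤ M * k ^ s × M * k ^ s ≤ suc E * ℓ ^ t
    hit (a , b , inj₁ ℓᵇ⋖kᵃ)
      with walk {a = a} {b} {E} {E} {M} {suc E} {0} {T₀} 0<k 0<ℓ 0<E 0<M
             (≤-reflexive (*-comm E (suc E))) ℓᵇ⋖kᵃ ascending-start
    ... | s , t , _ , T₀≤t , lower , upper = s , t , T₀≤t , lower , upper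
    hit (a , b , inj₂ kᵃ⋖ℓᵇ)
      with walk {a = b} {a} {E} {M * E} {E * suc E} {M * suc E} {T₀} {G} 0<ℓ 0<k 0<E (*-mono-< 0<E z<s)
             (≤-reflexive (eq₁ M E)) kᵃ⋖ℓᵇ descending-start
    ... | t , s , T₀≤t , _ , lower , upper =
      s , t , T₀≤t ,
      *-cancelˡ-≤ (suc E) (subst₂ _≤_ (eq₂ E (ℓ ^ t)) (eq₃ E M (k ^ s)) upper) ,
      *-cancelˡ-≤ E {{>-nonZero 0<E}} (subst₂ _≤_ (eq₄ M E (k ^ s)) (*-assoc E (suc E) (ℓ ^ t)) lower)

  ℓ^w*k^u≢k^s : ∀ {w u s} → 0 < w → ℓ ^ w * k ^ u ≢ k ^ s
  ℓ^w*k^u≢k^s {w} {u} {s} 0<w eq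
    with m≤n⇒∃[o]m+o≡n (m^n≤m^o⇒n≤o {k} {u} {s} 1<k (≤-trans (m≤n*m (k ^ u) (ℓ ^ w) {{m^n≢0 ℓ w}}) (≤-reflexive eq)))
  ... | d , refl = k^a≢ℓ^b d w 0<w (sym (*-cancelʳ-≡ (ℓ ^ w) (k ^ d) (k ^ u) {{m^n≢0 k u}}
    (trans eq (trans (^-distribˡ-+-* k u d) (*-comm (k ^ u) (k ^ d))))))

  overlap⇒below : ∀ {R s w u} → 0 < w → R ≤ s → ℓ ^ w * k ^ R ≤ k ^ s → Overlap k ℓ R s w u → ℓ ^ w * k ^ u < k ^ s
  overlap⇒below {R} {s} {w} {u} 0<w R≤s ℓʷkᴿ≤kˢ (lo , _) with <-cmp (ℓ ^ w * k ^ u) (k ^ s)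
  ... | tri< below _ _ = below
  ... | tri≈ _ eq _    = ⊥-elim (ℓ^w*k^u≢k^s {w} {u} {s} 0<w eq)
  ... | tri> _ _ above with u <? R
  ...   | yes u<R = ⊥-elim (<-asym above (<-≤-trans (*-monoʳ-< (ℓ ^ w) {{m^n≢0 ℓ w}} (^-monoʳ-< k 1<k u<R)) ℓʷkᴿ≤kˢ))
  ...   | no u≮R with m≤n⇒∃[o]m+o≡n (≮⇒≥ u≮R) | m≤n⇒∃[o]m+o≡n R≤s
  ...     | u′ , refl | s′ , refl =
    ⊥-elim (no-multiple-strictly-between {k ^ R} {k ^ s′}
      (subst₂ _<_ kˢ≡ ℓʷkᵘ≡ above) (subst₂ _<_ ℓʷkᵘ≡ (cong (_+ k ^ R) kˢ≡) lo))
    where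
    kˢ≡ : k ^ (R + s′) ≡ k ^ R * k ^ s′
    kˢ≡ = ^-distribˡ-+-* k R s′
    ℓʷkᵘ≡ : ℓ ^ w * k ^ (R + u′) ≡ k ^ R * (ℓ ^ w * k ^ u′)
    ℓʷkᵘ≡ = trans (cong (ℓ ^ w *_) (^-distribˡ-+-* k R u′)) (x∙yz≈y∙xz (ℓ ^ w) (k ^ R) (k ^ u′))

  far-from-ℓ^t*k^n : ∀ {n R T₀ t u} → R < n → ℓ ^ T₀ * k ^ R ≤ k ^ n → 0 < t → t ≤ T₀ →
    ℓ ^ t * k ^ n < k ^ u + k ^ R → k ^ u < ℓ ^ t * (k ^ n + k ^ R) → ⊥
  far-from-ℓ^t*k^n {n} {R} {T₀} {t} {u} R<n ℓᵀkᴿ≤kⁿ 0<t t≤T₀ lo hi with u <? n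
  ... | yes u<n = <⇒≱ lo (≤-trans (m^a+m^b≤m^n 1<k u<n R<n) (m≤n*m (k ^ n) (ℓ ^ t) {{m^n≢0 ℓ t}}))
  ... | no u≮n with m≤n⇒∃[o]m+o≡n (≮⇒≥ u≮n)
  ...   | e , refl with <-cmp (k ^ e) (ℓ ^ t)
  ...     | tri< kᵉ<ℓᵗ _ _ = <⇒≱ lo (begin
    k ^ (n + e) + k ^ R     ≤⟨ +-monoʳ-≤ (k ^ (n + e)) (^-monoʳ-≤ k (<⇒≤ R<n)) ⟩
    k ^ (n + e) + k ^ n     ≡⟨ cong (_+ k ^ n) (^-distribˡ-+-* k n e) ⟩
    k ^ n * k ^ e + k ^ n   ≡⟨ +-comm (k ^ n * k ^ e) (k ^ n) ⟩
    k ^ n + k ^ n * k ^ e   ≡⟨ *-suc (k ^ n) (k ^ e) ⟨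
    k ^ n * suc (k ^ e)     ≤⟨ *-monoʳ-≤ (k ^ n) kᵉ<ℓᵗ ⟩
    k ^ n * ℓ ^ t           ≡⟨ *-comm (k ^ n) (ℓ ^ t) ⟩
    ℓ ^ t * k ^ n           ∎)
    where open ≤-Reasoning
  ...     | tri≈ _ kᵉ≡ℓᵗ _ = k^a≢ℓ^b e t 0<t kᵉ≡ℓᵗ
  ...     | tri> _ _ ℓᵗ<kᵉ = <⇒≱ hi (begin
    ℓ ^ t * (k ^ n + k ^ R)         ≡⟨ *-distribˡ-+ (ℓ ^ t) (k ^ n) (k ^ R) ⟩
    ℓ ^ t * k ^ n + ℓ ^ t * k ^ R   ≤⟨ +-monoʳ-≤ (ℓ ^ t * k ^ n) (≤-trans (*-monoˡ-≤ (k ^ R) (^-monoʳ-≤ ℓ t≤T₀)) ℓᵀkᴿ≤kⁿ) ⟩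
    ℓ ^ t * k ^ n + k ^ n           ≡⟨ cong (_+ k ^ n) (*-comm (ℓ ^ t) (k ^ n)) ⟩
    k ^ n * ℓ ^ t + k ^ n           ≡⟨ +-comm (k ^ n * ℓ ^ t) (k ^ n) ⟩
    k ^ n + k ^ n * ℓ ^ t           ≡⟨ *-suc (k ^ n) (ℓ ^ t) ⟨
    k ^ n * suc (ℓ ^ t)             ≤⟨ *-monoʳ-≤ (k ^ n) ℓᵗ<kᵉ ⟩
    k ^ n * k ^ e                   ≡⟨ ^-distribˡ-+-* k n e ⟨
    k ^ (n + e)                     ∎)
    where open ≤-Reasoning

  overlap-quotient : ∀ {n R A B s w t u} → k ^ n < A → B ≤ k ^ n + k ^ R →
    ℓ ^ (w + t) * A ≤ k ^ s → k ^ s + k ^ R ≤ ℓ ^ (w + t) * B →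
    ℓ ^ w * k ^ u < k ^ s → k ^ s < ℓ ^ w * (k ^ u + k ^ R) →
    ℓ ^ t * k ^ n < k ^ u + k ^ R × k ^ u < ℓ ^ t * (k ^ n + k ^ R)
  overlap-quotient {n} {R} {A} {B} {s} {w} {t} {u} kⁿ<A B≤ lower upper below above =
    *-cancelˡ-< (ℓ ^ w) (ℓ ^ t * k ^ n) (k ^ u + k ^ R) (begin-strict
      ℓ ^ w * (ℓ ^ t * k ^ n)   ≡⟨ *-assoc (ℓ ^ w) (ℓ ^ t) (k ^ n) ⟨
      ℓ ^ w * ℓ ^ t * k ^ n     ≤⟨ *-monoʳ-≤ (ℓ ^ w * ℓ ^ t) (<⇒≤ kⁿ<A) ⟩
      ℓ ^ w * ℓ ^ t * A         ≡⟨ cong (_* A) ℓʷ⁺ᵗ≡ ⟨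
      ℓ ^ (w + t) * A           ≤⟨ lower ⟩
      k ^ s                     <⟨ above ⟩
      ℓ ^ w * (k ^ u + k ^ R)   ∎) ,
    *-cancelˡ-< (ℓ ^ w) (k ^ u) (ℓ ^ t * (k ^ n + k ^ R)) (begin-strict
      ℓ ^ w * k ^ u                    <⟨ below ⟩
      k ^ s                            ≤⟨ m≤m+n (k ^ s) (k ^ R) ⟩
      k ^ s + k ^ R                    ≤⟨ upper ⟩
      ℓ ^ (w + t) * B                  ≡⟨ cong (_* B) ℓʷ⁺ᵗ≡ ⟩
      ℓ ^ w * ℓ ^ t * B                ≤⟨ *-monoʳ-≤ (ℓ ^ w * ℓ ^ t) B≤ ⟩
      ℓ ^ w * ℓ ^ t * (k ^ n + k ^ R)  ≡⟨ *-assoc (ℓ ^ w) (ℓ ^ t) _ ⟩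
      ℓ ^ w * (ℓ ^ t * (k ^ n + k ^ R)) ∎)
    where
    open ≤-Reasoning
    ℓʷ⁺ᵗ≡ : ℓ ^ (w + t) ≡ ℓ ^ w * ℓ ^ t
    ℓʷ⁺ᵗ≡ = ^-distribˡ-+-* ℓ w t

  module Descent {n R T₀ A B s₀ t₀ : ℕ}
    (R<n : R < n) (ℓᵀkᴿ≤kⁿ : ℓ ^ T₀ * k ^ R ≤ k ^ n) (8kᴿ≤ℓᵀ : 8 * k ^ R ≤ ℓ ^ T₀) (0<T₀ : 0 < T₀)
    (kⁿ<A : k ^ n < A) (A<B : A < B) (B≤kⁿ+kᴿ : B ≤ k ^ n + k ^ R)
    (T₀≤t₀ : T₀ ≤ t₀) (lower₀ : (4 * A + 1) * ℓ ^ t₀ ≤ 4 * k ^ s₀) (upper₀ : 4 * k ^ s₀ ≤ (4 * A + 2) * ℓ ^ t₀)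
    where

    record Invariant (s t : ℕ) : Set where
      constructor invariant
      field
        T₀≤t   : T₀ ≤ t
        ratio  : k ^ s * ℓ ^ t₀ ≤ k ^ s₀ * ℓ ^ t
        padded : (k ^ s₀ + 2 * k ^ R) * ℓ ^ t ≤ (k ^ s + 2 * k ^ R) * ℓ ^ t₀

    invariant⇒lower : ∀ {s t} → Invariant s t → ℓ ^ t * A ≤ k ^ s
    invariant⇒lower {s} {t} (invariant T₀≤t _ padded) =
      ratio-lower-bound {A} {k ^ s} {k ^ s₀} {ℓ ^ t} {ℓ ^ t₀} {k ^ R} (m^n>0 ℓ t₀) lower₀ padded
        (≤-trans 8kᴿ≤ℓᵀ (^-monoʳ-≤ ℓ T₀≤t))

    invariant⇒upper : ∀ {s t} → Invariant s t → k ^ s + k ^ R ≤ ℓ ^ t * B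
    invariant⇒upper {s} {t} (invariant T₀≤t ratio _) =
      ratio-upper-bound {A} {B} {k ^ s} {k ^ s₀} {ℓ ^ t} {ℓ ^ t₀} {k ^ R} (m^n>0 ℓ t₀) upper₀ ratio
        (≤-trans (*-monoˡ-≤ (k ^ R) (m≤m+n 4 4)) (≤-trans 8kᴿ≤ℓᵀ (^-monoʳ-≤ ℓ T₀≤t))) A<B

    invariant⇒n<s : ∀ {s t} → Invariant s t → n < s
    invariant⇒n<s {s} {t} inv =
      m^n<m^o⇒n<o 1<k (<-≤-trans kⁿ<A (≤-trans (m≤n*m A (ℓ ^ t) {{m^n≢0 ℓ t}}) (invariant⇒lower inv)))

    invariant-step : ∀ {s w t u} → 0 < w → Invariant s (w + t) → T₀ ≤ t →
      ℓ ^ w * k ^ u < k ^ s → k ^ s < ℓ ^ w * (k ^ u + k ^ R) → Invariant u t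
    invariant-step {s} {w} {t} {u} 0<w (invariant _ ratio padded) T₀≤t below above = invariant T₀≤t
      (ratio-descends {ℓ ^ w} {k ^ s} {k ^ u} {k ^ s₀} {ℓ ^ t} {ℓ ^ t₀} (m^n>0 ℓ w) below
        (subst (λ P → k ^ s * ℓ ^ t₀ ≤ k ^ s₀ * P) ℓʷ⁺ᵗ≡ ratio))
      (padded-ratio-ascends {ℓ ^ w} {k ^ s} {k ^ u} {k ^ s₀} {ℓ ^ t} {ℓ ^ t₀} {k ^ R} 2≤ℓʷ above
        (subst (λ P → (k ^ s₀ + 2 * k ^ R) * P ≤ (k ^ s + 2 * k ^ R) * ℓ ^ t₀) ℓʷ⁺ᵗ≡ padded))
      where
      ℓʷ⁺ᵗ≡ : ℓ ^ (w + t) ≡ ℓ ^ w * ℓ ^ t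
      ℓʷ⁺ᵗ≡ = ^-distribˡ-+-* ℓ w t
      2≤ℓʷ : 2 ≤ ℓ ^ w
      2≤ℓʷ = ≤-trans 1<ℓ (≤-trans (≤-reflexive (sym (*-identityʳ ℓ))) (^-monoʳ-≤ ℓ 0<w))

    short-step-impossible : ∀ {s w t u} → Invariant s (w + t) → 0 < t → t < T₀ →
      ℓ ^ w * k ^ u < k ^ s → k ^ s < ℓ ^ w * (k ^ u + k ^ R) → ⊥
    short-step-impossible {s} {w} {t} {u} inv 0<t t<T₀ below above =
      uncurry (far-from-ℓ^t*k^n {n} {R} {T₀} {t} {u} R<n ℓᵀkᴿ≤kⁿ 0<t (<⇒≤ t<T₀))
        (overlap-quotient {n} {R} {A} {B} {s} {w} {t} {u} kⁿ<A B≤kⁿ+kᴿ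
          (invariant⇒lower inv) (invariant⇒upper inv) below above)

    BelowOverlap : ℕ → ℕ → Set
    BelowOverlap s t = ∃ λ w → w < t × 0 < w ×
      ∃ λ u → u < s × ℓ ^ w * k ^ u < k ^ s × k ^ s < ℓ ^ w * (k ^ u + k ^ R)

    belowOverlap? : ∀ s t → Dec (BelowOverlap s t)
    belowOverlap? s = anyUpTo? λ w → (0 <? w) ×-dec
      anyUpTo? (λ u → (ℓ ^ w * k ^ u <? k ^ s) ×-dec (k ^ s <? ℓ ^ w * (k ^ u + k ^ R))) s

    separated : ∀ {s t} → Invariant s t → ¬ BelowOverlap s t → Separated k ℓ R s t
    separated {s} {t} inv none w u 0<w w<t meet = none (w , w<t , 0<w , u , u<s , below , proj₂ meet)
      where
      ℓʷkᴿ≤kˢ : ℓ ^ w * k ^ R ≤ k ^ s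
      ℓʷkᴿ≤kˢ = ≤-trans (*-mono-≤ (^-monoʳ-≤ ℓ (<⇒≤ w<t)) (≤-trans (^-monoʳ-≤ k (<⇒≤ R<n)) (<⇒≤ kⁿ<A)))
                        (invariant⇒lower inv)
      below : ℓ ^ w * k ^ u < k ^ s
      below = overlap⇒below {R} {s} {w} {u} 0<w (<⇒≤ (<-trans R<n (invariant⇒n<s inv))) ℓʷkᴿ≤kˢ meet
      u<s : u < s
      u<s = m^n<m^o⇒n<o 1<k (≤-<-trans (m≤n*m (k ^ u) (ℓ ^ w) {{m^n≢0 ℓ w}}) below)

    descend : ∀ t s → Invariant s t → Solution k ℓ R n A B
    descend = <-rec _ step
      where
      step : ∀ t → (∀ {t′} → t′ < t → ∀ s → Invariant s t′ → Solution k ℓ R n A B) →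
        ∀ s → Invariant s t → Solution k ℓ R n A B
      step t descend′ s inv with belowOverlap? s t
      ... | no none = s , t , invariant⇒n<s inv , <-≤-trans 0<T₀ (Invariant.T₀≤t inv) ,
                      invariant⇒lower inv , invariant⇒upper inv , separated inv none
      ... | yes (w , w<t , 0<w , u , _ , below , above) with m≤n⇒∃[o]m+o≡n (<⇒≤ w<t)
      ...   | t′ , refl with T₀ ≤? t′
      ...     | yes T₀≤t′ = descend′ (m<n+m t′ 0<w) u (invariant-step 0<w inv T₀≤t′ below above)
      ...     | no  T₀≰t′ = ⊥-elim (short-step-impossible {u = u} inv 0<t′ (≰⇒> T₀≰t′) below above)
        where
        0<t′ : 0 < t′
        0<t′ = +-cancelˡ-< w 0 t′ (subst (_< w + t′) (sym (+-identityʳ w)) w<t)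

    solution : Solution k ℓ R n A B
    solution = descend t₀ s₀ (invariant T₀≤t₀ ≤-refl ≤-refl)

  separated-intervals : ∀ R → ∃ λ N → R < N × (∀ n → N ≤ n → ∀ r → r < R →
    Solution k ℓ R n (k ^ n + k ^ r) (k ^ n + k ^ (r + 1)))
  separated-intervals R = suc (R + ℓ ^ T₀) , s≤s (m≤m+n R (ℓ ^ T₀)) , solve
    where
    T₀ = 8 * k ^ R
    solve : ∀ n → suc (R + ℓ ^ T₀) ≤ n → ∀ r → r < R → Solution k ℓ R n (k ^ n + k ^ r) (k ^ n + k ^ (r + 1))
    solve n N≤n r r<R = descend (ratio-in-window {4 * A + 1} {4} T₀ z<s 4<4A+1)
      where
      A = k ^ n + k ^ r
      B = k ^ n + k ^ (r + 1)
      R<n : R < n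
      R<n = <-≤-trans (s≤s (m≤m+n R (ℓ ^ T₀))) N≤n
      ℓᵀkᴿ≤kⁿ : ℓ ^ T₀ * k ^ R ≤ k ^ n
      ℓᵀkᴿ≤kⁿ = begin
        ℓ ^ T₀ * k ^ R       ≤⟨ *-monoˡ-≤ (k ^ R) (<⇒≤ (n<m^n 1<k (ℓ ^ T₀))) ⟩
        k ^ ℓ ^ T₀ * k ^ R   ≡⟨ ^-distribˡ-+-* k (ℓ ^ T₀) R ⟨
        k ^ (ℓ ^ T₀ + R)     ≤⟨ ^-monoʳ-≤ k (≤-trans (≤-reflexive (+-comm (ℓ ^ T₀) R)) (≤-trans (n≤1+n _) N≤n)) ⟩
        k ^ n                ∎
        where open ≤-Reasoning
      kⁿ<A : k ^ n < A
      kⁿ<A = m<m+n (k ^ n) (m^n>0 k r)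
      A<B : A < B
      A<B = +-monoʳ-< (k ^ n) (^-monoʳ-< k 1<k (m<m+n r z<s))
      B≤kⁿ+kᴿ : B ≤ k ^ n + k ^ R
      B≤kⁿ+kᴿ = +-monoʳ-≤ (k ^ n) (^-monoʳ-≤ k (subst (_≤ R) (+-comm 1 r) r<R))
      4<4A+1 : 4 < 4 * A + 1
      4<4A+1 = <-≤-trans (s≤s (*-monoʳ-≤ 4 (<-≤-trans z<s kⁿ<A))) (≤-reflexive (+-comm 1 (4 * A)))
      descend : (∃₂ λ s t → T₀ ≤ t × (4 * A + 1) * ℓ ^ t ≤ 4 * k ^ s × 4 * k ^ s ≤ suc (4 * A + 1) * ℓ ^ t) →
        Solution k ℓ R n A B
      descend (s₀ , t₀ , T₀≤t₀ , lower₀ , upper₀) =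
        Descent.solution {n} {R} {T₀} {A} {B} {s₀} {t₀}
          R<n ℓᵀkᴿ≤kⁿ (<⇒≤ (n<m^n 1<ℓ T₀)) (≤-trans (m^n>0 k R) (m≤n*m (k ^ R) 8)) kⁿ<A A<B B≤kⁿ+kᴿ
          T₀≤t₀ lower₀ (subst (λ c → 4 * k ^ s₀ ≤ c * ℓ ^ t₀) (sym (+-suc (4 * A) 1)) upper₀)

MultIndep⇒k^a≢ℓ^b : ∀ {k ℓ} → 1 < ℓ → MultIndep k ℓ → ∀ a b → 0 < b → k ^ a ≢ ℓ ^ b
MultIndep⇒k^a≢ℓ^b {ℓ = ℓ} 1<ℓ _ zero b 0<b = <⇒≢ (^-monoʳ-< ℓ 1<ℓ 0<b)
MultIndep⇒k^a≢ℓ^b _ indep (suc a) b 0<b kᵃ≡ℓᵇ =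
  indep (ℤ.+ suc a) (ℤ.+ b) (λ ()) (λ b≡0 → <⇒≢ 0<b (sym (ℤₚ.+-injective b≡0))) (cong ℕtoℚ kᵃ≡ℓᵇ)

separated⇒disjoint : ∀ {k ℓ R s t} → 0 < ℓ → Separated k ℓ R s t → (u v : ℕ) → 1 ≤ v → v < t →
  Disjoint (scale (invℕ (ℓ ^ t)) (Ico (ℕtoℚ (k ^ s)) (ℕtoℚ (k ^ s + k ^ R))))
           (scale (invℕ (ℓ ^ v)) (Ico (ℕtoℚ (k ^ u)) (ℕtoℚ (k ^ u + k ^ R))))
separated⇒disjoint {k} {ℓ} {R} {s} {t} 0<ℓ separated u v 0<v v<t x in-t in-v =
  separated (t ∸ v) u (m<n⇒0<n∸m v<t) (∸-monoʳ-< 0<v (<⇒≤ v<t))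
    (scale-Ico-meet {ℓ ^ (t ∸ v)} {ℓ ^ v} {ℓ ^ t} {k ^ s} {k ^ s + k ^ R} {k ^ u} {k ^ u + k ^ R}
      (m^n>0 ℓ (t ∸ v)) (m^n>0 ℓ v) ℓᵗ≡ in-t in-v)
  where
  instance
    _ : NonZero ℓ
    _ = >-nonZero 0<ℓ
  ℓᵗ≡ : ℓ ^ t ≡ ℓ ^ (t ∸ v) * ℓ ^ v
  ℓᵗ≡ = trans (cong (ℓ ^_) (sym (m∸n+n≡m (<⇒≤ v<t)))) (^-distribˡ-+-* ℓ (t ∸ v) v)

lemma2p2 : (k ℓ : ℕ) → 1 < k → 1 < ℓ → k < ℓ → MultIndep k ℓ → (R : ℕ) →
    ∃ λ N → R < N × ((n : ℕ) → N ≤ n → (r : ℕ) → r < R →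
      ∃ λ s → ∃ λ t → n < s × 0 < t ×
        (scale (invℕ (ℓ ^ t)) (Ico (ℕtoℚ (k ^ s)) (ℕtoℚ (k ^ s + k ^ R)))
          ⊆ Ico (ℕtoℚ (k ^ n + k ^ r)) (ℕtoℚ (k ^ n + k ^ (r + 1))))
        × ((u v : ℕ) → 1 ≤ v → v < t →
          Disjoint (scale (invℕ (ℓ ^ t)) (Ico (ℕtoℚ (k ^ s)) (ℕtoℚ (k ^ s + k ^ R))))
                   (scale (invℕ (ℓ ^ v)) (Ico (ℕtoℚ (k ^ u)) (ℕtoℚ (k ^ u + k ^ R))))))
lemma2p2 k ℓ 1<k 1<ℓ _ indep R =
  let N , R<N , solutions = separated-intervals {k} {ℓ} 1<k 1<ℓ (MultIndep⇒k^a≢ℓ^b {k} {ℓ} 1<ℓ indep) R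
  in N , R<N , λ n N≤n r r<R →
    let s , t , n<s , 0<t , lower , upper , separated = solutions n N≤n r r<R
    in s , t , n<s , 0<t ,
       scale-Ico-⊆ {ℓ ^ t} {k ^ s} {k ^ s + k ^ R} {k ^ n + k ^ r} {k ^ n + k ^ (r + 1)} (m^n>0 ℓ t) lower upper ,
       separated⇒disjoint {k} {ℓ} {R} {s} {t} 0<ℓ separated
  where
  0<ℓ : 0 < ℓ
  0<ℓ = <-trans z<s 1<ℓ
  instance
    _ : NonZero ℓ
    _ = >-nonZero 0<ℓ
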